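{- Let $a\in\mathbb{C}$, $\mathbf{k}=(k_1,\ldots,k_r)\in\mathbb{N}^r$, $\mathbf{x}=(x_1,\ldots,x_r)$ with $|x_j|\le1$, $n\in\mathbb{N}$ and $l\in\mathbb{N}_0$. Then \[ \sum_{n\ge n_1\ge\cdots\ge n_r>0}\prod_{j=1}^r\frac{x_j^{n_j+l+a}}{(n_j+l+a)^{k_j}}=(-1)^r\sum_{j=0}^r(-1)^j\zeta^\star_{n+l}(k_1,\ldots,k_j;x_1,\ldots,x_j;a)\,\zeta_l(k_r,\ldots,k_{j+1};x_r,\ldots,x_{j+1};a). \]
   Context: $\zeta_N(k_1,\ldots,k_s;y_1,\ldots,y_s;a)=\sum_{N\ge n_1>\cdots>n_s\ge1}\prod_i\frac{y_i^{n_i+a}}{(n_i+a)^{k_i}}$ and $\zeta^\star_N(k_1,\ldots,k_s;y_1,\ldots,y_s;a)=\sum_{N\ge n_1\ge\cdots\ge n_s\ge1}\prod_i\frac{y_i^{n_i+a}}{(n_i+a)^{k_i}}$, equal to $1$ for the empty index, empty sums being $0$. Here $a$ is not a negative integer, and $y^{m+a}$ means $y^m y^a$ for a fixed determination of each $y_i^a$. -}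

module Defs where

open import Level using (Level)
open import Data.Nat using (ℕ; zero; suc; _∸_) renaming (_+_ to _+ℕ_)
open import Data.Product using (_×_; _,_; proj₁)
open import Data.List using (List; []; _∷_)
open import Algebra.Apartness.Bundles using (HeytingField)

-- Everything is developed over an arbitrary Heyting field F (a constructive
-- field with apartness, e.g. the complex numbers), since agda-stdlib has no ℂ.
module Zeta {c ℓ₁ ℓ₂ : Level} (F : HeytingField c ℓ₁ ℓ₂) where
  open HeytingField F using (Carrier; _+_; _*_; 0#; 1#; _#_; #⇒invertible)

  ι : ℕ → Carrier
  ι zero    = 0#
  ι (suc n) = 1# + ι n

  pow : Carrier → ℕ → Carrier
  pow y zero    = 1#
  pow y (suc n) = y * pow y n

  sum1 : ℕ → (ℕ → Carrier) → Carrier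
  sum1 zero    f = 0#
  sum1 (suc N) f = sum1 N f + f (suc N)

  sum0 : ℕ → (ℕ → Carrier) → Carrier
  sum0 zero    f = f zero
  sum0 (suc N) f = sum0 N f + f (suc N)

  -- an index entry (k_i , y_i , y_i^a): the exponent k_i, the argument y_i,
  -- and a fixed determination of y_i^a (so y^{m+a} := y^m * y^a)
  Entry : Set c
  Entry = ℕ × Carrier × Carrier

  NotNegInt : Carrier → Set ℓ₂
  NotNegInt a = ∀ m → (ι (suc m) + a) # 0#

  module WithA (a : Carrier) (ok : NotNegInt a) where

    inv : ℕ → Carrier
    inv m = proj₁ (#⇒invertible (ok m))

    -- term (k , y , ya) m = y^{m+a} / (m+a)^k   for m ≥ 1 (value at 0 unused)
    term : Entry → ℕ → Carrier
    term e zero                = 0#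
    term (k , y , ya) (suc m)  = (pow y (suc m) * ya) * pow (inv m) k

    -- ζ_N(k;y;a) : strict inequalities N ≥ n_1 > n_2 > ... > n_s ≥ 1
    ζ : ℕ → List Entry → Carrier
    ζ N []       = 1#
    ζ N (e ∷ es) = sum1 N (λ n → term e n * ζ (n ∸ 1) es)

    -- ζ⋆_N(k;y;a) : N ≥ n_1 ≥ n_2 ≥ ... ≥ n_s ≥ 1
    ζ⋆ : ℕ → List Entry → Carrier
    ζ⋆ N []       = 1#
    ζ⋆ N (e ∷ es) = sum1 N (λ n → term e n * ζ⋆ n es)

    shifted⋆ : ℕ → ℕ → List Entry → Carrier
    shifted⋆ l N []       = 1#
    shifted⋆ l N (e ∷ es) = sum1 N (λ n → term e (n +ℕ l) * shifted⋆ l n es)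

{-# OPTIONS --safe #-}
-- Write ζ⋆_M(es ; > l) for the sum over M ≥ m₁ ≥ ⋯ ≥ m_r > l, so that the left-hand
-- side is ζ⋆_{n+l}(es ; > l), and A_{M,l}(es) for the alternating sum on the right.
-- Appending an entry v and splitting the last index of ζ⋆_M(ws v) at l gives
--   ζ⋆_M(ws v) = ζ⋆_M(ws v ; > l) + Σ_{m ≤ l} term v m · ζ⋆_M(ws ; > m-1),
-- while expanding ζ_l(v, …) in its first index recombines the summands j < r of A_{M,l}(ws v):
--   A_{M,l}(ws v) = Σ_{m ≤ l} term v m · A_{M,m-1}(ws) + (-1)^r ζ⋆_M(ws v).
-- Induction on es from the right then yields A_{M,l}(es) = (-1)^r ζ⋆_M(es ; > l) for l ≤ M.
module Submission where

open import Defs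
open import Level using (Level)
open import Data.Nat using (ℕ; _≤_) renaming (_+_ to _+ℕ_)
open import Data.Product using (proj₁)
open import Data.List using (List; length; take; drop; reverse)
open import Data.List.Relation.Unary.All using (All)
open import Algebra.Apartness.Bundles using (HeytingField)

open import Data.Nat using (zero; suc; _∸_; _<_; _≤?_; z≤n; s≤s)
open import Data.Nat.Properties
  using (≤-refl; ≤-trans; ≤-antisym; <⇒≤; <⇒≱; ≰⇒>; ≤-pred; m≤n⇒m≤1+n; m≤n+m; +-comm)
open import Data.List using ([]; _∷_; _∷ʳ_)
open import Data.List.Properties using (length-++; take-all; drop-all; reverse-++)
open import Data.List.Reverse using (Reverse; []; _∶_∶ʳ_; reverseView)
open import Relation.Nullary using (yes; no; ¬_)
open import Relation.Nullary.Negation using (contradiction)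
open import Relation.Binary.PropositionalEquality as P using (_≡_)
open import Algebra.Bundles using (CommutativeRing)
open import Algebra.Apartness.Bundles using (HeytingCommutativeRing)
import Algebra.Properties.Ring as RingProperties
import Algebra.Properties.AbelianGroup as AbelianGroupProperties
import Algebra.Properties.CommutativeSemigroup as CommutativeSemigroupProperties
import Relation.Binary.Reasoning.Setoid as SetoidReasoning

module _ {a} {A : Set a} where

  length-∷ʳ : ∀ (xs : List A) x → length (xs ∷ʳ x) ≡ suc (length xs)
  length-∷ʳ xs x = P.trans (length-++ xs) (+-comm (length xs) 1)

  take-∷ʳ : ∀ j (xs : List A) x → j ≤ length xs → take j (xs ∷ʳ x) ≡ take j xs
  take-∷ʳ zero    xs       x _         = P.refl
  take-∷ʳ (suc j) (y ∷ xs) x (s≤s j≤n) = P.cong (y ∷_) (take-∷ʳ j xs x j≤n)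

  drop-∷ʳ : ∀ j (xs : List A) x → j ≤ length xs → drop j (xs ∷ʳ x) ≡ drop j xs ∷ʳ x
  drop-∷ʳ zero    xs       x _         = P.refl
  drop-∷ʳ (suc j) (y ∷ xs) x (s≤s j≤n) = drop-∷ʳ j xs x j≤n

module Sums {c ℓ₁ ℓ₂ : Level} (F : HeytingField c ℓ₁ ℓ₂) where
  open HeytingCommutativeRing (HeytingField.heytingCommutativeRing F) using (commutativeRing)
  open CommutativeRing commutativeRing hiding (zero)
  open Zeta F using (sum1; sum0; pow)
  open RingProperties ring using (-1*x≈-x; -‿involutive)
  open AbelianGroupProperties +-abelianGroup using (xyx⁻¹≈y)
  open CommutativeSemigroupProperties *-commutativeSemigroup using (x∙yz≈y∙xz; interchange)
  open CommutativeSemigroupProperties +-commutativeSemigroup using () renaming (interchange to +-interchange)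
  open SetoidReasoning setoid

  sum1-cong : ∀ N {f h : ℕ → Carrier} → (∀ k → k < N → f (suc k) ≈ h (suc k)) → sum1 N f ≈ sum1 N h
  sum1-cong zero    _  = refl
  sum1-cong (suc N) eq = +-cong (sum1-cong N (λ k k<N → eq k (m≤n⇒m≤1+n k<N))) (eq N ≤-refl)

  sum0-cong : ∀ N {f h : ℕ → Carrier} → (∀ j → j ≤ N → f j ≈ h j) → sum0 N f ≈ sum0 N h
  sum0-cong zero    eq = eq zero z≤n
  sum0-cong (suc N) eq = +-cong (sum0-cong N (λ j j≤N → eq j (m≤n⇒m≤1+n j≤N))) (eq (suc N) ≤-refl)

  sum1-zero : ∀ N → sum1 N (λ _ → 0#) ≈ 0#
  sum1-zero zero    = refl
  sum1-zero (suc N) = trans (+-identityʳ _) (sum1-zero N)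

  sum1-distrib-+ : ∀ N (f h : ℕ → Carrier) → sum1 N (λ m → f m + h m) ≈ sum1 N f + sum1 N h
  sum1-distrib-+ zero    f h = sym (+-identityʳ 0#)
  sum1-distrib-+ (suc N) f h =
    trans (+-congʳ (sum1-distrib-+ N f h)) (+-interchange _ _ _ _)

  *-distribˡ-sum1 : ∀ N x (f : ℕ → Carrier) → x * sum1 N f ≈ sum1 N (λ m → x * f m)
  *-distribˡ-sum1 zero    x f = zeroʳ x
  *-distribˡ-sum1 (suc N) x f = trans (distribˡ x _ _) (+-congʳ (*-distribˡ-sum1 N x f))

  *-distribˡ-sum0 : ∀ N x (f : ℕ → Carrier) → x * sum0 N f ≈ sum0 N (λ j → x * f j)
  *-distribˡ-sum0 zero    x f = refl
  *-distribˡ-sum0 (suc N) x f = trans (distribˡ x _ _) (+-congʳ (*-distribˡ-sum0 N x f))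

  sum1-comm : ∀ N K (G : ℕ → ℕ → Carrier) →
    sum1 N (λ p → sum1 K (G p)) ≈ sum1 K (λ m → sum1 N (λ p → G p m))
  sum1-comm zero    K G = sym (sum1-zero K)
  sum1-comm (suc N) K G =
    trans (+-congʳ (sum1-comm N K G)) (sym (sum1-distrib-+ K _ _))

  sum0-sum1-comm : ∀ N K (G : ℕ → ℕ → Carrier) →
    sum0 N (λ j → sum1 K (G j)) ≈ sum1 K (λ m → sum0 N (λ j → G j m))
  sum0-sum1-comm zero    K G = refl
  sum0-sum1-comm (suc N) K G =
    trans (+-congʳ (sum0-sum1-comm N K G)) (sym (sum1-distrib-+ K _ _))

  [_≤_]_ : ℕ → ℕ → Carrier → Carrier
  [ i ≤ j ] x with i ≤? j
  ... | yes _ = x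
  ... | no  _ = 0#

  guard-≤ : ∀ {i j} x → i ≤ j → [ i ≤ j ] x ≈ x
  guard-≤ {i} {j} x i≤j with i ≤? j
  ... | yes _   = refl
  ... | no  i≰j = contradiction i≤j i≰j

  guard-≰ : ∀ {i j} x → ¬ i ≤ j → [ i ≤ j ] x ≈ 0#
  guard-≰ {i} {j} x i≰j with i ≤? j
  ... | yes i≤j = contradiction i≤j i≰j
  ... | no  _   = refl

  guard-cong : ∀ i j {x y} → x ≈ y → [ i ≤ j ] x ≈ [ i ≤ j ] y
  guard-cong i j x≈y with i ≤? j
  ... | yes _ = x≈y
  ... | no  _ = refl

  guard-*-sum1 : ∀ i j N x (f : ℕ → Carrier) →
    [ i ≤ j ] (x * sum1 N f) ≈ sum1 N (λ m → [ i ≤ j ] (x * f m))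
  guard-*-sum1 i j N x f with i ≤? j
  ... | yes _ = *-distribˡ-sum1 N x f
  ... | no  _ = sym (sum1-zero N)

  -- Since l ≤ m ≤ p forces l ≤ p, the guard on p is absorbed once m ≤ p is imposed.
  guard-exchange : ∀ l m p x y z →
    [ m ≤ p ] ([ l ≤ p ] (x * [ l ≤ m ] (y * z))) ≈ [ l ≤ m ] (y * [ m ≤ p ] (x * z))
  guard-exchange l m p x y z with l ≤? p | m ≤? p | l ≤? m
  ... | yes _   | yes _   | yes _   = x∙yz≈y∙xz x y z
  ... | yes _   | yes _   | no  _   = zeroʳ x
  ... | yes _   | no  _   | yes _   = sym (zeroʳ y)
  ... | yes _   | no  _   | no  _   = refl
  ... | no  l≰p | yes m≤p | yes l≤m = contradiction (≤-trans l≤m m≤p) l≰p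
  ... | no  _   | yes _   | no  _   = refl
  ... | no  _   | no  _   | yes _   = sym (zeroʳ y)
  ... | no  _   | no  _   | no  _   = refl

  sum1-guard-≤ : ∀ M p (f : ℕ → Carrier) → p ≤ M → sum1 M (λ m → [ m ≤ p ] f m) ≈ sum1 p f
  sum1-guard-≤ zero    .zero f z≤n = refl
  sum1-guard-≤ (suc M) p     f p≤1+M with p ≤? M
  ... | yes p≤M = trans (+-cong (sum1-guard-≤ M p f p≤M) (guard-≰ _ (<⇒≱ (s≤s p≤M)))) (+-identityʳ _)
  ... | no  p≰M with ≤-antisym p≤1+M (≰⇒> p≰M)
  ...   | P.refl = +-cong (sum1-cong M (λ k k<M → guard-≤ _ (m≤n⇒m≤1+n k<M))) (guard-≤ {suc M} {suc M} _ ≤-refl)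

  sum1-triangle : ∀ M (H : ℕ → ℕ → Carrier) →
    sum1 M (λ p → sum1 p (H p)) ≈ sum1 M (λ m → sum1 M (λ p → [ m ≤ p ] H p m))
  sum1-triangle M H = begin
    sum1 M (λ p → sum1 p (H p))
      ≈⟨ sum1-cong M (λ p p<M → sum1-guard-≤ M (suc p) (H (suc p)) p<M) ⟨
    sum1 M (λ p → sum1 M (λ m → [ m ≤ p ] H p m))
      ≈⟨ sum1-comm M M _ ⟩
    sum1 M (λ m → sum1 M (λ p → [ m ≤ p ] H p m)) ∎

  sum1-guard-shift : ∀ n l (f : ℕ → Carrier) →
    sum1 (n +ℕ l) (λ p → [ suc l ≤ p ] f p) ≈ sum1 n (λ d → f (d +ℕ l))
  sum1-guard-shift zero    l f =
    trans (sum1-cong l (λ k k<l → guard-≰ _ (λ l<k → <⇒≱ k<l (≤-pred l<k)))) (sum1-zero l)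
  sum1-guard-shift (suc n) l f =
    +-cong (sum1-guard-shift n l f) (guard-≤ _ (s≤s (m≤n+m l n)))

  guard-split : ∀ l m x → [ suc l ≤ m ] x + [ m ≤ l ] x ≈ x
  guard-split l m x with suc l ≤? m | m ≤? l
  ... | yes l<m | yes m≤l = contradiction m≤l (<⇒≱ l<m)
  ... | yes _   | no  _   = +-identityʳ x
  ... | no  _   | yes _   = +-identityˡ x
  ... | no  l≮m | no  m≰l = contradiction (≰⇒> m≰l) l≮m

  sum1-split : ∀ l M (f : ℕ → Carrier) → l ≤ M →
    sum1 M f ≈ sum1 M (λ m → [ suc l ≤ m ] f m) + sum1 l f
  sum1-split l M f l≤M = begin
    sum1 M f
      ≈⟨ sum1-cong M (λ m _ → guard-split l (suc m) (f (suc m))) ⟨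
    sum1 M (λ m → [ suc l ≤ m ] f m + [ m ≤ l ] f m)
      ≈⟨ sum1-distrib-+ M _ _ ⟩
    sum1 M (λ m → [ suc l ≤ m ] f m) + sum1 M (λ m → [ m ≤ l ] f m)
      ≈⟨ +-congˡ (sum1-guard-≤ M l f l≤M) ⟩
    sum1 M (λ m → [ suc l ≤ m ] f m) + sum1 l f ∎

  sign-square : ∀ k → pow (- 1#) k * pow (- 1#) k ≈ 1#
  sign-square zero    = *-identityˡ 1#
  sign-square (suc k) = begin
    (- 1# * pow (- 1#) k) * (- 1# * pow (- 1#) k) ≈⟨ interchange _ _ _ _ ⟩
    (- 1# * - 1#) * (pow (- 1#) k * pow (- 1#) k) ≈⟨ *-cong (trans (-1*x≈-x (- 1#)) (-‿involutive 1#)) (sign-square k) ⟩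
    1# * 1#                                        ≈⟨ *-identityˡ 1# ⟩
    1#                                             ∎

  sign-cancel : ∀ k x → x ≈ pow (- 1#) k * (pow (- 1#) k * x)
  sign-cancel k x = sym (begin
    s * (s * x) ≈⟨ *-assoc s s x ⟨
    (s * s) * x ≈⟨ *-congʳ (sign-square k) ⟩
    1# * x      ≈⟨ *-identityˡ x ⟩
    x           ∎)
    where
    s : Carrier
    s = pow (- 1#) k

  x*y+[-1*x]*[z+y]≈[-1*x]*z : ∀ x y z → x * y + (- 1# * x) * (z + y) ≈ (- 1# * x) * z
  x*y+[-1*x]*[z+y]≈[-1*x]*z x y z = begin
    x * y + u * (z + y)          ≈⟨ +-congˡ (distribˡ u z y) ⟩
    x * y + (u * z + u * y)      ≈⟨ +-congˡ (+-congˡ (trans (*-assoc _ x y) (-1*x≈-x (x * y)))) ⟩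
    x * y + (u * z + - (x * y))  ≈⟨ +-assoc _ _ _ ⟨
    x * y + u * z + - (x * y)    ≈⟨ xyx⁻¹≈y (x * y) (u * z) ⟩
    u * z                        ∎
    where
    u : Carrier
    u = - 1# * x

module Alternating {c ℓ₁ ℓ₂ : Level} (F : HeytingField c ℓ₁ ℓ₂)
                   (a : HeytingField.Carrier F) (ok : Zeta.NotNegInt F a) where
  open HeytingCommutativeRing (HeytingField.heytingCommutativeRing F) using (commutativeRing)
  open CommutativeRing commutativeRing hiding (zero)
  open Zeta F using (sum1; sum0; pow; Entry)
  open Zeta.WithA F a ok
  open Sums F
  open CommutativeSemigroupProperties *-commutativeSemigroup using (x∙yz≈y∙xz)
  open SetoidReasoning setoid

  -- The bound m_{i+1} ≤ m_i is the
  -- range of the inner sum and the bound > l is a guard, so that nested sums can be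
  -- exchanged over a full square (sum1-triangle).
  ζ⋆-between : ℕ → ℕ → List Entry → Carrier
  ζ⋆-between l M []       = 1#
  ζ⋆-between l M (e ∷ es) = sum1 M (λ m → [ suc l ≤ m ] (term e m * ζ⋆-between l m es))

  shifted⋆≈ζ⋆-between : ∀ l n es → shifted⋆ l n es ≈ ζ⋆-between l (n +ℕ l) es
  shifted⋆≈ζ⋆-between l n []       = refl
  shifted⋆≈ζ⋆-between l n (e ∷ es) = sym (trans (sum1-guard-shift n l _)
    (sum1-cong n (λ d _ → *-congˡ (sym (shifted⋆≈ζ⋆-between l (suc d) es)))))

  ζ⋆≈ζ⋆-between : ∀ M es → ζ⋆ M es ≈ ζ⋆-between 0 M es
  ζ⋆≈ζ⋆-between M []       = refl
  ζ⋆≈ζ⋆-between M (e ∷ es) = sum1-cong M (λ m _ →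
    sym (trans (guard-≤ {1} {suc m} _ (s≤s z≤n)) (*-congˡ (sym (ζ⋆≈ζ⋆-between (suc m) es)))))

  ζ⋆-between-∷ʳ : ∀ ws v l M → ζ⋆-between l M (ws ∷ʳ v)
    ≈ sum1 M (λ m → [ suc l ≤ m ] (term v m * ζ⋆-between (m ∸ 1) M ws))
  ζ⋆-between-∷ʳ []       v l M = refl
  ζ⋆-between-∷ʳ (w ∷ ws) v l M = begin
    sum1 M (λ p → [ suc l ≤ p ] (term w p * ζ⋆-between l p (ws ∷ʳ v)))
      ≈⟨ sum1-cong M (λ p _ → guard-cong (suc l) (suc p) (*-congˡ (ζ⋆-between-∷ʳ ws v l (suc p)))) ⟩
    sum1 M (λ p → [ suc l ≤ p ] (term w p * sum1 p (λ m → H p m)))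
      ≈⟨ sum1-cong M (λ p _ → guard-*-sum1 (suc l) (suc p) (suc p) _ _) ⟩
    sum1 M (λ p → sum1 p (λ m → [ suc l ≤ p ] (term w p * H p m)))
      ≈⟨ sum1-triangle M _ ⟩
    sum1 M (λ m → sum1 M (λ p → [ m ≤ p ] ([ suc l ≤ p ] (term w p * H p m))))
      ≈⟨ sum1-cong M (λ m _ → sum1-cong M (λ p _ → guard-exchange (suc l) (suc m) (suc p) _ _ _)) ⟩
    sum1 M (λ m → sum1 M (λ p → [ suc l ≤ m ] (term v m * [ m ≤ p ] (term w p * Z p m))))
      ≈⟨ sum1-cong M (λ m _ → guard-*-sum1 (suc l) (suc m) M _ _) ⟨
    sum1 M (λ m → [ suc l ≤ m ] (term v m * ζ⋆-between (m ∸ 1) M (w ∷ ws))) ∎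
    where
    Z : ℕ → ℕ → Carrier
    Z p m = ζ⋆-between (m ∸ 1) p ws
    H : ℕ → ℕ → Carrier
    H p m = [ suc l ≤ m ] (term v m * Z p m)

  ζ⋆-∷ʳ-split : ∀ ws v l M → l ≤ M → ζ⋆ M (ws ∷ʳ v)
    ≈ ζ⋆-between l M (ws ∷ʳ v) + sum1 l (λ m → term v m * ζ⋆-between (m ∸ 1) M ws)
  ζ⋆-∷ʳ-split ws v l M l≤M = begin
    ζ⋆ M (ws ∷ʳ v)                                ≈⟨ ζ⋆≈ζ⋆-between M (ws ∷ʳ v) ⟩
    ζ⋆-between 0 M (ws ∷ʳ v)                      ≈⟨ ζ⋆-between-∷ʳ ws v 0 M ⟩
    sum1 M (λ m → [ 1 ≤ m ] h m)                  ≈⟨ sum1-cong M (λ m _ → guard-≤ {1} {suc m} _ (s≤s z≤n)) ⟩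
    sum1 M h                                      ≈⟨ sum1-split l M h l≤M ⟩
    sum1 M (λ m → [ suc l ≤ m ] h m) + sum1 l h   ≈⟨ +-congʳ (ζ⋆-between-∷ʳ ws v l M) ⟨
    ζ⋆-between l M (ws ∷ʳ v) + sum1 l h           ∎
    where
    h : ℕ → Carrier
    h m = term v m * ζ⋆-between (m ∸ 1) M ws

  alternating : ℕ → ℕ → List Entry → Carrier
  alternating M l es =
    sum0 (length es) (λ j → pow (- 1#) j * (ζ⋆ M (take j es) * ζ l (reverse (drop j es))))

  alternating-∷ʳ : ∀ ws v l M → alternating M l (ws ∷ʳ v)
    ≈ sum1 l (λ m → term v m * alternating M (m ∸ 1) ws) + pow (- 1#) (suc (length ws)) * ζ⋆ M (ws ∷ʳ v)
  alternating-∷ʳ ws v l M rewrite length-∷ʳ ws v = +-cong (begin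
    sum0 k T                                          ≈⟨ sum0-cong k T-∷ʳ ⟩
    sum0 k (λ j → sum1 l (λ m → term v m * U m j))    ≈⟨ sum0-sum1-comm k l _ ⟩
    sum1 l (λ m → sum0 k (λ j → term v m * U m j))    ≈⟨ sum1-cong l (λ m _ → *-distribˡ-sum0 k _ _) ⟨
    sum1 l (λ m → term v m * sum0 k (U m))            ∎) T-last
    where
    k : ℕ
    k = length ws
    es : List Entry
    es = ws ∷ʳ v
    T : ℕ → Carrier
    T j = pow (- 1#) j * (ζ⋆ M (take j es) * ζ l (reverse (drop j es)))
    U : ℕ → ℕ → Carrier
    U m j = pow (- 1#) j * (ζ⋆ M (take j ws) * ζ (m ∸ 1) (reverse (drop j ws)))

    T-∷ʳ : ∀ j → j ≤ k → T j ≈ sum1 l (λ m → term v m * U m j)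
    T-∷ʳ j j≤k rewrite take-∷ʳ j ws v j≤k | drop-∷ʳ j ws v j≤k | reverse-++ (drop j ws) (v ∷ []) =
      trans (*-congˡ (*-distribˡ-sum1 l _ _))
        (trans (*-distribˡ-sum1 l _ _)
          (sum1-cong l (λ m _ → trans (*-congˡ (x∙yz≈y∙xz _ _ _)) (x∙yz≈y∙xz _ _ _))))

    T-last : T (suc k) ≈ pow (- 1#) (suc k) * ζ⋆ M es
    T-last rewrite P.sym (length-∷ʳ ws v) | take-all (length es) es ≤-refl | drop-all (length es) es ≤-refl =
      *-congˡ (*-identityʳ _)

  alternating≈sign*ζ⋆-between : ∀ {es} → Reverse es → ∀ l M → l ≤ M →
    alternating M l es ≈ pow (- 1#) (length es) * ζ⋆-between l M es
  alternating≈sign*ζ⋆-between [] l M _ = *-congˡ (*-identityˡ 1#)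
  alternating≈sign*ζ⋆-between (ws ∶ rws ∶ʳ v) l M l≤M = begin
    alternating M l (ws ∷ʳ v)
      ≈⟨ alternating-∷ʳ ws v l M ⟩
    sum1 l (λ m → term v m * alternating M (m ∸ 1) ws) + (- 1# * s) * ζ⋆ M (ws ∷ʳ v)
      ≈⟨ +-cong (sum1-cong l (λ m m<l → *-congˡ (IH m m<l))) (*-congˡ (ζ⋆-∷ʳ-split ws v l M l≤M)) ⟩
    sum1 l (λ m → term v m * (s * Z m)) + (- 1# * s) * (ζ⋆-between l M (ws ∷ʳ v) + sum1 l h)
      ≈⟨ +-congʳ (trans (sum1-cong l (λ m _ → x∙yz≈y∙xz _ _ _)) (sym (*-distribˡ-sum1 l s h))) ⟩
    s * sum1 l h + (- 1# * s) * (ζ⋆-between l M (ws ∷ʳ v) + sum1 l h)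
      ≈⟨ x*y+[-1*x]*[z+y]≈[-1*x]*z s _ _ ⟩
    (- 1# * s) * ζ⋆-between l M (ws ∷ʳ v)
      ≈⟨ *-congʳ (reflexive (P.cong (pow (- 1#)) (length-∷ʳ ws v))) ⟨
    pow (- 1#) (length (ws ∷ʳ v)) * ζ⋆-between l M (ws ∷ʳ v) ∎
    where
    s : Carrier
    s = pow (- 1#) (length ws)
    Z : ℕ → Carrier
    Z m = ζ⋆-between (m ∸ 1) M ws
    h : ℕ → Carrier
    h m = term v m * Z m
    IH : ∀ m → m < l → alternating M m ws ≈ s * Z (suc m)
    IH m m<l = alternating≈sign*ζ⋆-between rws m M (≤-trans (<⇒≤ m<l) l≤M)

theorem4p8 : ∀ {c ℓ₁ ℓ₂ : Level} (F : HeytingField c ℓ₁ ℓ₂) →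
    let open HeytingField F
        open Zeta F
    in (a : Carrier) (ok : NotNegInt a) →
       let open WithA a ok
       in (es : List Entry) → All (λ e → 1 ≤ proj₁ e) es →
          (n l : ℕ) → 1 ≤ n →
          shifted⋆ l n es
            ≈ pow (- 1#) (length es)
              * sum0 (length es) (λ j → pow (- 1#) j
                   * (ζ⋆ (n +ℕ l) (take j es) * ζ l (reverse (drop j es))))
theorem4p8 F a ok es _ n l _ = begin
  shifted⋆ l n es                   ≈⟨ shifted⋆≈ζ⋆-between l n es ⟩
  ζ⋆-between l M es                 ≈⟨ sign-cancel (length es) _ ⟩
  sign * (sign * ζ⋆-between l M es) ≈⟨ *-congˡ (alternating≈sign*ζ⋆-between (reverseView es) l M (m≤n+m l n)) ⟨
  sign * alternating M l es         ∎
  where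
  open HeytingField F using (Carrier; _*_; -_; 1#; setoid; *-congˡ)
  open Zeta F using (pow)
  open Zeta.WithA F a ok using (shifted⋆)
  open Sums F using (sign-cancel)
  open Alternating F a ok
  open SetoidReasoning setoid
  M : ℕ
  M = n +ℕ l
  sign : Carrier
  sign = pow (- 1#) (length es)
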